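{- Let $p$ be an odd prime and $m$ a positive integer not divisible by $p$. For $r\in\mathbb Z$ let $K_p(r,m)=\sum_{1\leqslant k\leqslant p-1,\ m\mid k-rp}\frac1k$. Then $$\sum_{r=1}^m rK_p(r,m)\equiv-q_p(m)\pmod p,$$ where $q_p(m)=(m^{p-1}-1)/p$ is the Fermat quotient.
   Context: The congruence is between rational numbers with denominators prime to $p$. -}

module Defs where

open import Data.Nat as ℕ using (ℕ; suc; _∸_; _^_)
open import Data.Nat.Primality using (Prime; prime⇒nonZero)
open import Data.Nat.Divisibility using (_∣?_)
open import Data.Integer as ℤ using (ℤ; +_)
open import Data.Integer.Divisibility renaming (_∣_ to _∣ℤ_)
open import Data.Rational as ℚ using (ℚ; 0ℚ; _+_; _-_; _*_; ↥_; ↧ₙ_)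
open import Data.List using (List; foldr; map; upTo)
open import Relation.Nullary using (¬_; does)
open import Data.Bool using (if_then_else_)
open import Data.Product using (_×_)

sumℚ : List ℚ → ℚ
sumℚ = foldr _+_ 0ℚ

-- Σ_{a ≤ i ≤ b} f i  (empty when b < a)
Σ[_to_] : ℕ → ℕ → (ℕ → ℚ) → ℚ
Σ[ a to b ] f = sumℚ (map (λ i → f (a ℕ.+ i)) (upTo (suc b ∸ a)))

-- 1 / k as a rational (1/0 := 0 by convention; never used with k = 0)
inv : ℕ → ℚ
inv 0 = 0ℚ
inv (suc k) = (+ 1) ℚ./ suc k

divides? : ℕ → ℤ → Data.Bool.Bool
divides? m z = does (m ∣? ℤ.∣ z ∣)

K : ℕ → ℤ → ℕ → ℚ
K p r m = Σ[ 1 to p ∸ 1 ] (λ k →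
  if divides? m (+ k ℤ.- r ℤ.* + p) then inv k else 0ℚ)

fermatQuotient : (p : ℕ) → Prime p → ℕ → ℚ
fermatQuotient p pp m = (+ (m ^ (p ∸ 1)) ℤ.- + 1) ℚ./ p
  where instance _ = prime⇒nonZero pp

-- congruence mod p of rationals: x - y, in lowest terms, has numerator
-- divisible by p and denominator prime to p (i.e. v_p(x - y) ≥ 1)
_≡_[modℚ_] : ℚ → ℚ → ℕ → Set
x ≡ y [modℚ p ] = ((+ p) ∣ℤ (↥ (x - y))) × ¬ (p Data.Nat.Divisibility.∣ (↧ₙ (x - y)))

{-# OPTIONS --safe #-}

-- Since p is invertible modulo m, every k has a unique r_k ∈ [1, m] with m ∣ k − r_k p, and the
-- double sum collapses to S = Σ_{0<k<p} r_k / k. Write r_k p = k + m j_k. Then 0 < j_k < p and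
-- k ↦ j_k is injective, hence a permutation of {1, …, p − 1}; as p − 1 is even,
--   ∏_k (k − p r_k) = ∏_k (−m j_k) = m^(p−1) ∏_k k.
-- Expanding the left side to first order in p gives ∏_k k − p (∏_k k) S modulo p², so
-- (m^(p−1) − 1) ∏_k k ≡ −p (∏_k k) S (mod p²) and, cancelling the unit ∏_k k, q_p(m) ≡ −S (mod p).

module Submission where

open import Defs
open import Data.Nat using (ℕ; _≡ᵇ_; _>_)
open import Data.Nat.Primality using (Prime)
open import Data.Nat.Divisibility using (_∣_)
open import Data.Integer using (+_)
open import Data.Rational using (ℚ; _*_; -_)
open import Relation.Nullary using (¬_)

open import Level using (0ℓ)
open import Function using (_∘_)
open import Data.Bool using (if_then_else_)
open import Data.Maybe using (nothing)
open import Data.Product using (∃; _×_; _,_; proj₁; proj₂)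
open import Data.Sum using (inj₁; inj₂)
open import Data.Nat as ℕ using (zero; suc; NonZero; _<_; _≤_; _^_; z<s; s<s)
import Data.Nat.Properties as ℕ
open import Data.Nat.DivMod using (_/_; m*[n/m]≡n)
open import Data.Nat.Divisibility as ℕ∣ using (_∤_; _∣?_)
open import Data.Nat.Coprimality as Coprimality using (Coprime; coprime-Bézout; coprime-divisor)
open import Data.Nat.GCD using (module Bézout)
open import Data.Nat.Primality using (euclidsLemma; prime⇒irreducible; ¬prime[0]; ¬prime[1])
open import Data.Nat.ListAction using (product)
open import Data.Nat.ListAction.Properties using (product-↭)
open import Data.Integer as ℤ using (ℤ)
import Data.Integer.Properties as ℤ
open import Data.Integer.DivMod using (_%ℕ_; _/ℕ_; n%ℕd<d; a≡a%ℕn+[a/ℕn]*n)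
open import Data.Integer.Divisibility.Signed as ℤ∣ using (divides; ∣⇒∣ᵤ; ∣ᵤ⇒∣) renaming (_∣_ to _∣ℤ_)
open import Data.Integer.Tactic.RingSolver using (solve-∀)
open import Data.Rational as ℚ using (_+_; _-_; 0ℚ; 1ℚ; ↥_; ↧_; ↧ₙ_; toℚᵘ)
import Data.Rational.Properties as ℚ
open import Data.Rational.Unnormalised as ℚᵘ using (mkℚᵘ)
import Data.Rational.Unnormalised.Properties as ℚᵘ
open import Data.List using (List; []; _∷_; [_]; _++_; foldr; map; upTo; length)
open import Data.List.Properties using (map-cong; map-cong-local; map-∘; map-id; length-map; length-upTo)
open import Data.List.Membership.Propositional using (_∈_)
open import Data.List.Membership.Propositional.Properties using (∈-∃++; ∈-map⁺; ∈-map⁻; ∈-upTo⁺; ∈-upTo⁻)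
open import Data.List.Relation.Binary.Subset.Propositional using (_⊆_)
open import Data.List.Relation.Binary.Permutation.Propositional using (_↭_; ↭-refl; prep; module PermutationReasoning)
open import Data.List.Relation.Binary.Permutation.Propositional.Properties using (shift; ∈-resp-↭; ↭-length)
open import Data.List.Relation.Unary.Any using (here; there)
open import Data.List.Relation.Unary.All as All using (All; []; _∷_)
import Data.List.Relation.Unary.All.Properties as All
open import Data.List.Relation.Unary.Unique.Propositional using (Unique; []; _∷_)
open import Data.List.Relation.Unary.Unique.Propositional.Properties using (upTo⁺) renaming (map⁺ to Unique-map⁺)
open import Algebra.Properties.AbelianGroup ℤ.+-0-abelianGroup using (xyx⁻¹≈y; ⁻¹-anti-homo‿-)
open import Algebra.Properties.CommutativeSemigroup ℕ.*-commutativeSemigroup using () renaming (interchange to ℕ-*-interchange)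
open import Tactic.RingSolver.Core.AlmostCommutativeRing using (AlmostCommutativeRing; fromCommutativeRing)
import Tactic.RingSolver as RingSolver
open import Relation.Binary.PropositionalEquality using (_≡_; _≢_; refl; sym; trans; cong; cong₂; subst; module ≡-Reasoning)
open import Relation.Nullary using (contradiction)
open import Relation.Nullary.Decidable using (dec-true; dec-false)

ℚ-ring : AlmostCommutativeRing 0ℓ 0ℓ
ℚ-ring = fromCommutativeRing ℚ.+-*-commutativeRing (λ _ → nothing)

fromℤ : ℤ → ℚ
fromℤ i = i ℚ./ 1

toℚᵘ-fromℤ : ∀ i → toℚᵘ (fromℤ i) ℚᵘ.≃ mkℚᵘ i 0
toℚᵘ-fromℤ i = ℚ.toℚᵘ-fromℚᵘ (mkℚᵘ i 0)

fromℤ-homo-+ : ∀ i j → fromℤ (i ℤ.+ j) ≡ fromℤ i + fromℤ j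
fromℤ-homo-+ i j = ℚ.toℚᵘ-injective (begin
  toℚᵘ (fromℤ (i ℤ.+ j))             ≈⟨ toℚᵘ-fromℤ (i ℤ.+ j) ⟩
  mkℚᵘ (i ℤ.+ j) 0                   ≡⟨ cong₂ (λ a b → mkℚᵘ (a ℤ.+ b) 0) (ℤ.*-identityʳ i) (ℤ.*-identityʳ j) ⟨
  mkℚᵘ i 0 ℚᵘ.+ mkℚᵘ j 0             ≈⟨ ℚᵘ.+-cong (toℚᵘ-fromℤ i) (toℚᵘ-fromℤ j) ⟨
  toℚᵘ (fromℤ i) ℚᵘ.+ toℚᵘ (fromℤ j) ≈⟨ ℚ.toℚᵘ-homo-+ (fromℤ i) (fromℤ j) ⟨
  toℚᵘ (fromℤ i + fromℤ j)           ∎)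
  where open ℚᵘ.≃-Reasoning

fromℤ-homo-* : ∀ i j → fromℤ (i ℤ.* j) ≡ fromℤ i * fromℤ j
fromℤ-homo-* i j = ℚ.toℚᵘ-injective (begin
  toℚᵘ (fromℤ (i ℤ.* j))             ≈⟨ toℚᵘ-fromℤ (i ℤ.* j) ⟩
  mkℚᵘ i 0 ℚᵘ.* mkℚᵘ j 0             ≈⟨ ℚᵘ.*-cong (toℚᵘ-fromℤ i) (toℚᵘ-fromℤ j) ⟨
  toℚᵘ (fromℤ i) ℚᵘ.* toℚᵘ (fromℤ j) ≈⟨ ℚ.toℚᵘ-homo-* (fromℤ i) (fromℤ j) ⟨
  toℚᵘ (fromℤ i * fromℤ j)           ∎)
  where open ℚᵘ.≃-Reasoning

fromℤ-*-inv : ∀ k .{{_ : NonZero k}} → fromℤ (+ k) * inv k ≡ 1ℚ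
fromℤ-*-inv (suc k) = ℚ.toℚᵘ-injective (begin
  toℚᵘ (fromℤ (+ suc k) * inv (suc k))            ≈⟨ ℚ.toℚᵘ-homo-* (fromℤ (+ suc k)) (inv (suc k)) ⟩
  toℚᵘ (fromℤ (+ suc k)) ℚᵘ.* toℚᵘ (inv (suc k)) ≈⟨ ℚᵘ.*-cong (toℚᵘ-fromℤ (+ suc k)) (ℚ.toℚᵘ-fromℚᵘ (mkℚᵘ (+ 1) k)) ⟩
  mkℚᵘ (+ suc k) 0 ℚᵘ.* mkℚᵘ (+ 1) k             ≈⟨ ℚᵘ.*-inverseʳ (mkℚᵘ (+ suc k) 0) ⟩
  ℚᵘ.1ℚᵘ                                         ∎)
  where open ℚᵘ.≃-Reasoning

i*n/n≡i : ∀ i n .{{_ : NonZero n}} → (i ℤ.* + n) ℚ./ n ≡ fromℤ i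
i*n/n≡i i (suc n) = ℚ.fromℚᵘ-cong {mkℚᵘ (i ℤ.* + suc n) n} {mkℚᵘ i 0} (ℚᵘ.*≡* (ℤ.*-identityʳ (i ℤ.* + suc n)))

cross-multiply : ∀ z D N → z * fromℤ (+ D) ≡ fromℤ N → ↥ z ℤ.* + D ≡ N ℤ.* ↧ z
cross-multiply z@record{} D N eq =
  trans (sym (ℤ.*-identityʳ _)) (trans (ℚᵘ.drop-*≡* eqᵘ) (cong (λ d → N ℤ.* + d) (ℕ.*-identityʳ (↧ₙ z))))
  where
  open ℚᵘ.≃-Reasoning
  eqᵘ : toℚᵘ z ℚᵘ.* mkℚᵘ (+ D) 0 ℚᵘ.≃ mkℚᵘ N 0
  eqᵘ = begin
    toℚᵘ z ℚᵘ.* mkℚᵘ (+ D) 0        ≈⟨ ℚᵘ.*-congˡ {toℚᵘ z} (toℚᵘ-fromℤ (+ D)) ⟨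
    toℚᵘ z ℚᵘ.* toℚᵘ (fromℤ (+ D))  ≈⟨ ℚ.toℚᵘ-homo-* z (fromℤ (+ D)) ⟨
    toℚᵘ (z * fromℤ (+ D))          ≡⟨ cong toℚᵘ eq ⟩
    toℚᵘ (fromℤ N)                  ≈⟨ toℚᵘ-fromℤ N ⟩
    mkℚᵘ N 0                        ∎

numerator-coprime-denominator : ∀ q → Coprime ℤ.∣ ↥ q ∣ (↧ₙ q)
numerator-coprime-denominator (ℚ.mkℚ _ _ coprime) = Coprimality.recompute coprime

multiple-of-p⇒≡[modℚ] : ∀ {p} → Prime p → ∀ x y {D} N → p ∤ D →
                        (x - y) * fromℤ (+ D) ≡ fromℤ (+ p ℤ.* N) → x ≡ y [modℚ p ]
multiple-of-p⇒≡[modℚ] {p} pp x y {D} N p∤D eq = p∣numerator , p∤denominator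
  where
  z = x - y
  ∣↥z∣*D≡p*∣N∣*↧z : ℤ.∣ ↥ z ∣ ℕ.* D ≡ p ℕ.* ℤ.∣ N ∣ ℕ.* ↧ₙ z
  ∣↥z∣*D≡p*∣N∣*↧z = begin
    ℤ.∣ ↥ z ∣ ℕ.* D           ≡⟨ ℤ.abs-* (↥ z) (+ D) ⟨
    ℤ.∣ ↥ z ℤ.* + D ∣         ≡⟨ cong ℤ.∣_∣ (cross-multiply z D (+ p ℤ.* N) eq) ⟩
    ℤ.∣ + p ℤ.* N ℤ.* ↧ z ∣   ≡⟨ ℤ.abs-* (+ p ℤ.* N) (↧ z) ⟩
    ℤ.∣ + p ℤ.* N ∣ ℕ.* ↧ₙ z  ≡⟨ cong (ℕ._* ↧ₙ z) (ℤ.abs-* (+ p) N) ⟩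
    p ℕ.* ℤ.∣ N ∣ ℕ.* ↧ₙ z    ∎
    where open ≡-Reasoning
  p∣numerator : p ∣ ℤ.∣ ↥ z ∣
  p∣numerator with euclidsLemma ℤ.∣ ↥ z ∣ D pp
                     (subst (p ∣_) (sym ∣↥z∣*D≡p*∣N∣*↧z) (ℕ∣.∣m⇒∣m*n (↧ₙ z) (ℕ∣.m∣m*n ℤ.∣ N ∣)))
  ... | inj₁ p∣∣↥z∣ = p∣∣↥z∣
  ... | inj₂ p∣D    = contradiction p∣D p∤D
  p∤denominator : p ∤ ↧ₙ z
  p∤denominator p∣↧z = ¬prime[1] (subst Prime (numerator-coprime-denominator z (p∣numerator , p∣↧z)) pp)

module _ {a} {A : Set a} where

  sumℚ-map-0 : ∀ {f : A → ℚ} {xs} → All (λ x → f x ≡ 0ℚ) xs → sumℚ (map f xs) ≡ 0ℚ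
  sumℚ-map-0 []             = refl
  sumℚ-map-0 (fx≡0 ∷ fxs≡0) = trans (cong₂ _+_ fx≡0 (sumℚ-map-0 fxs≡0)) (ℚ.+-identityˡ 0ℚ)

  sumℚ-map-+ : ∀ (f g : A → ℚ) xs → sumℚ (map (λ x → f x + g x) xs) ≡ sumℚ (map f xs) + sumℚ (map g xs)
  sumℚ-map-+ f g []       = sym (ℚ.+-identityˡ 0ℚ)
  sumℚ-map-+ f g (x ∷ xs) = trans (cong (_+_ (f x + g x)) (sumℚ-map-+ f g xs)) (interchange (f x) (g x) _ _)
    where
    interchange : ∀ a b c d → a + b + (c + d) ≡ a + c + (b + d)
    interchange = RingSolver.solve-∀ ℚ-ring

  *-distribˡ-sumℚ : ∀ c (f : A → ℚ) xs → c * sumℚ (map f xs) ≡ sumℚ (map (λ x → c * f x) xs)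
  *-distribˡ-sumℚ c f []       = ℚ.*-zeroʳ c
  *-distribˡ-sumℚ c f (x ∷ xs) = trans (ℚ.*-distribˡ-+ c (f x) _) (cong (_+_ (c * f x)) (*-distribˡ-sumℚ c f xs))

  sumℚ-map-single : ∀ {f : A → ℚ} {x xs} → Unique xs → x ∈ xs → (∀ {y} → y ∈ xs → y ≢ x → f y ≡ 0ℚ) →
                    sumℚ (map f xs) ≡ f x
  sumℚ-map-single {f} (x∉xs ∷ _) (here refl) vanish =
    trans (cong (_+_ (f _)) (sumℚ-map-0 (All.tabulate λ y∈xs → vanish (there y∈xs) (λ { refl → All.lookup x∉xs y∈xs refl }))))
          (ℚ.+-identityʳ _)
  sumℚ-map-single (y∉xs ∷ u) (there x∈xs) vanish =
    trans (cong₂ _+_ (vanish (here refl) (λ { refl → All.lookup y∉xs x∈xs refl })) (sumℚ-map-single u x∈xs (vanish ∘ there)))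
          (ℚ.+-identityˡ _)

sumℚ-map-comm : ∀ {a b} {A : Set a} {B : Set b} (h : A → B → ℚ) xs ys →
                sumℚ (map (λ x → sumℚ (map (h x) ys)) xs) ≡ sumℚ (map (λ y → sumℚ (map (λ x → h x y) xs)) ys)
sumℚ-map-comm h []       ys = sym (sumℚ-map-0 (All.universal (λ _ → refl) ys))
sumℚ-map-comm h (x ∷ xs) ys = trans (cong (_+_ (sumℚ (map (h x) ys))) (sumℚ-map-comm h xs ys))
                                    (sym (sumℚ-map-+ (h x) (λ y → sumℚ (map (λ x → h x y) xs)) ys))

map⁺-injectiveOn : ∀ {a b} {A : Set a} {B : Set b} {f : A → B} {xs} →
                   (∀ {x y} → x ∈ xs → y ∈ xs → f x ≡ f y → x ≡ y) → Unique xs → Unique (map f xs)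
map⁺-injectiveOn inj []         = []
map⁺-injectiveOn inj (x∉xs ∷ u) =
  All.map⁺ (All.tabulate (λ y∈xs fx≡fy → All.lookup x∉xs y∈xs (inj (here refl) (there y∈xs) fx≡fy)))
  ∷ map⁺-injectiveOn (λ x∈xs y∈xs → inj (there x∈xs) (there y∈xs)) u

module _ {a} {A : Set a} where

  unique∧⊆∧length≤⇒↭ : ∀ {xs ys : List A} → Unique xs → xs ⊆ ys → length ys ≤ length xs → xs ↭ ys
  unique∧⊆∧length≤⇒↭ {[]}     {[]} _          _       _   = ↭-refl
  unique∧⊆∧length≤⇒↭ {x ∷ xs} {ys} (x∉xs ∷ u) x∷xs⊆ys len
    with us , vs , refl ← ∈-∃++ (x∷xs⊆ys (here refl)) = begin
      x ∷ xs             ↭⟨ prep x (unique∧⊆∧length≤⇒↭ u xs⊆us++vs len′) ⟩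
      x ∷ us ++ vs       ↭⟨ shift x us vs ⟨
      us ++ [ x ] ++ vs  ∎
    where
    open PermutationReasoning
    xs⊆us++vs : xs ⊆ us ++ vs
    xs⊆us++vs y∈xs with ∈-resp-↭ (shift x us vs) (x∷xs⊆ys (there y∈xs))
    ... | here y≡x       = contradiction (sym y≡x) (All.lookup x∉xs y∈xs)
    ... | there y∈us++vs = y∈us++vs
    len′ : length (us ++ vs) ≤ length xs
    len′ = ℕ.≤-pred (subst (_≤ suc (length xs)) (↭-length (shift x us vs)) len)

  injective-endo⇒map↭ : ∀ {f : A → A} {xs} → Unique xs → (∀ {x} → x ∈ xs → f x ∈ xs) →
                        (∀ {x y} → x ∈ xs → y ∈ xs → f x ≡ f y → x ≡ y) → map f xs ↭ xs
  injective-endo⇒map↭ {f} {xs} u maps-into inj =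
    unique∧⊆∧length≤⇒↭ (map⁺-injectiveOn inj u) f[xs]⊆xs (ℕ.≤-reflexive (sym (length-map f xs)))
    where
    f[xs]⊆xs : map f xs ⊆ xs
    f[xs]⊆xs fx∈ with x , x∈xs , refl ← ∈-map⁻ f fx∈ = maps-into x∈xs

productℤ : List ℤ → ℤ
productℤ = foldr ℤ._*_ (+ 1)

module _ {a} {A : Set a} where

  productℤ-map-pos : ∀ (f : A → ℕ) xs → productℤ (map (λ x → + f x) xs) ≡ + product (map f xs)
  productℤ-map-pos f []       = refl
  productℤ-map-pos f (x ∷ xs) = trans (cong (+ f x ℤ.*_) (productℤ-map-pos f xs)) (sym (ℤ.pos-* (f x) _))

  productℤ-map-neg : ∀ (f : A → ℤ) xs → 2 ∣ length xs → productℤ (map (λ x → ℤ.- f x) xs) ≡ productℤ (map f xs)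
  productℤ-map-neg f []           _       = refl
  productℤ-map-neg f (x ∷ [])     2∣1     = contradiction (ℕ∣.∣1⇒≡1 2∣1) λ ()
  productℤ-map-neg f (x ∷ y ∷ xs) 2∣2+len = trans
    (cong (λ r → ℤ.- f x ℤ.* (ℤ.- f y ℤ.* r)) (productℤ-map-neg f xs (ℕ∣.∣m+n∣m⇒∣n 2∣2+len (ℕ∣.n∣n {2}))))
    (neg*neg (f x) (f y) _)
    where
    neg*neg : ∀ a b c → ℤ.- a ℤ.* (ℤ.- b ℤ.* c) ≡ a ℤ.* (b ℤ.* c)
    neg*neg = solve-∀

  product-map-* : ∀ m (f : A → ℕ) xs → product (map (λ x → m ℕ.* f x) xs) ≡ m ^ length xs ℕ.* product (map f xs)
  product-map-* m f []       = refl
  product-map-* m f (x ∷ xs) = trans (cong (m ℕ.* f x ℕ.*_) (product-map-* m f xs)) (ℕ-*-interchange m (f x) _ _)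

  linearTerm : (a b : A → ℤ) → List A → ℤ
  linearTerm a b []       = + 0
  linearTerm a b (x ∷ xs) = b x ℤ.* productℤ (map a xs) ℤ.+ a x ℤ.* linearTerm a b xs

  productℤ-expansion : ∀ (P : ℤ) (a b : A → ℤ) xs → ∃ λ T →
    productℤ (map (λ x → a x ℤ.- P ℤ.* b x) xs) ≡ productℤ (map a xs) ℤ.- P ℤ.* linearTerm a b xs ℤ.+ P ℤ.* P ℤ.* T
  productℤ-expansion P a b []       = + 0 , trivial P
    where
    trivial : ∀ P → + 1 ≡ + 1 ℤ.- P ℤ.* + 0 ℤ.+ P ℤ.* P ℤ.* + 0
    trivial = solve-∀
  productℤ-expansion P a b (x ∷ xs) with T , eq ← productℤ-expansion P a b xs =
    a x ℤ.* T ℤ.+ b x ℤ.* linearTerm a b xs ℤ.- P ℤ.* b x ℤ.* T ,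
    trans (cong ((a x ℤ.- P ℤ.* b x) ℤ.*_) eq) (step (a x) (b x) P (productℤ (map a xs)) (linearTerm a b xs) T)
    where
    step : ∀ a b P A L T →
           (a ℤ.- P ℤ.* b) ℤ.* (A ℤ.- P ℤ.* L ℤ.+ P ℤ.* P ℤ.* T)
             ≡ a ℤ.* A ℤ.- P ℤ.* (b ℤ.* A ℤ.+ a ℤ.* L) ℤ.+ P ℤ.* P ℤ.* (a ℤ.* T ℤ.+ b ℤ.* L ℤ.- P ℤ.* b ℤ.* T)
    step = solve-∀

fromℤ-linearTerm : ∀ (b : ℕ → ℤ) ks → All NonZero ks →
  fromℤ (linearTerm +_ b ks) ≡ fromℤ (productℤ (map +_ ks)) * sumℚ (map (λ k → fromℤ (b k) * inv k) ks)
fromℤ-linearTerm b []       []           = refl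
fromℤ-linearTerm b (k ∷ ks) (k≢0 ∷ ks≢0) = begin
  fromℤ (b k ℤ.* Π ℤ.+ + k ℤ.* linearTerm +_ b ks)
    ≡⟨ fromℤ-homo-+ (b k ℤ.* Π) (+ k ℤ.* linearTerm +_ b ks) ⟩
  fromℤ (b k ℤ.* Π) + fromℤ (+ k ℤ.* linearTerm +_ b ks)
    ≡⟨ cong₂ _+_ (fromℤ-homo-* (b k) Π) (fromℤ-homo-* (+ k) (linearTerm +_ b ks)) ⟩
  fromℤ (b k) * fromℤ Π + fromℤ (+ k) * fromℤ (linearTerm +_ b ks)
    ≡⟨ cong₂ (λ u v → u + fromℤ (+ k) * v) (sym (ℚ.*-identityʳ (fromℤ (b k) * fromℤ Π))) (fromℤ-linearTerm b ks ks≢0) ⟩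
  fromℤ (b k) * fromℤ Π * 1ℚ + fromℤ (+ k) * (fromℤ Π * S)
    ≡⟨ cong (λ u → fromℤ (b k) * fromℤ Π * u + fromℤ (+ k) * (fromℤ Π * S)) (fromℤ-*-inv k {{k≢0}}) ⟨
  fromℤ (b k) * fromℤ Π * (fromℤ (+ k) * inv k) + fromℤ (+ k) * (fromℤ Π * S)
    ≡⟨ regroup (fromℤ (b k)) (fromℤ Π) (fromℤ (+ k)) (inv k) S ⟩
  fromℤ (+ k) * fromℤ Π * (fromℤ (b k) * inv k + S)
    ≡⟨ cong (_* (fromℤ (b k) * inv k + S)) (fromℤ-homo-* (+ k) Π) ⟨
  fromℤ (+ k ℤ.* Π) * (fromℤ (b k) * inv k + S)
    ∎
  where
  open ≡-Reasoning
  Π = productℤ (map +_ ks)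
  S = sumℚ (map (λ k → fromℤ (b k) * inv k) ks)
  regroup : ∀ β π κ ι σ → β * π * (κ * ι) + κ * (π * σ) ≡ κ * π * (β * ι + σ)
  regroup = RingSolver.solve-∀ ℚ-ring

∣∧<⇒≡0 : ∀ {n x} → n ∣ x → x < n → x ≡ 0
∣∧<⇒≡0 {x = zero}  _   _   = refl
∣∧<⇒≡0 {x = suc _} n∣x x<n = contradiction n∣x (ℕ∣.>⇒∤ x<n)

∣∣a-b∣∧<⇒≡ : ∀ {n a b} → n ∣ ℤ.∣ + a ℤ.- + b ∣ → a < n → b < n → a ≡ b
∣∣a-b∣∧<⇒≡ {n} {a} {b} n∣∣a-b∣ a<n b<n =
  ℤ.+-injective (ℤ.i-j≡0⇒i≡j (+ a) (+ b) (ℤ.∣i∣≡0⇒i≡0 (∣∧<⇒≡0 n∣∣a-b∣ ∣a-b∣<n)))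
  where
  ∣a-b∣<n : ℤ.∣ + a ℤ.- + b ∣ < n
  ∣a-b∣<n = begin-strict
    ℤ.∣ + a ℤ.- + b ∣  ≡⟨ cong ℤ.∣_∣ (ℤ.[+m]-[+n]≡m⊖n a b) ⟩
    ℤ.∣ a ℤ.⊖ b ∣      ≤⟨ ℤ.∣m⊝n∣≤m⊔n a b ⟩
    a ℕ.⊔ b            <⟨ ℕ.⊔-pres-<m a<n b<n ⟩
    n                  ∎
    where open ℕ.≤-Reasoning

∣ℤ⇒≡k+m*[n∸k]/m : ∀ {m k n} .{{_ : NonZero m}} → k ≤ n → + m ∣ℤ + k ℤ.- + n →
                  n ≡ k ℕ.+ m ℕ.* ((n ℕ.∸ k) / m)
∣ℤ⇒≡k+m*[n∸k]/m {m} {k} {n} k≤n m∣k-n = begin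
  n                            ≡⟨ ℕ.m+[n∸m]≡n k≤n ⟨
  k ℕ.+ (n ℕ.∸ k)              ≡⟨ cong (k ℕ.+_) (m*[n/m]≡n m∣n-k) ⟨
  k ℕ.+ m ℕ.* ((n ℕ.∸ k) / m)  ∎
  where
  open ≡-Reasoning
  n-k≡-[k-n] : + (n ℕ.∸ k) ≡ ℤ.- (+ k ℤ.- + n)
  n-k≡-[k-n] = trans (sym (ℤ.≤-⊖ k≤n)) (trans (sym (ℤ.[+m]-[+n]≡m⊖n n k)) (sym (⁻¹-anti-homo‿- (+ k) (+ n))))
  m∣n-k : m ∣ n ℕ.∸ k
  m∣n-k = ∣⇒∣ᵤ (subst (+ m ∣ℤ_) (sym n-k≡-[k-n]) (ℤ∣.∣m⇒∣-m m∣k-n))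

prime∧∤⇒coprime : ∀ {p n} → Prime p → p ∤ n → Coprime p n
prime∧∤⇒coprime pp p∤n (d∣p , d∣n) with prime⇒irreducible pp d∣p
... | inj₁ d≡1 = d≡1
... | inj₂ refl = contradiction d∣n p∤n

prime∤product : ∀ {p} → Prime p → ∀ {ns} → All (p ∤_) ns → p ∤ product ns
prime∤product pp []           p∣1     = ¬prime[1] (subst Prime (ℕ∣.∣1⇒≡1 p∣1) pp)
prime∤product pp (p∤n ∷ p∤ns) p∣n*ns with euclidsLemma _ _ pp p∣n*ns
... | inj₁ p∣n  = p∤n p∣n
... | inj₂ p∣ns = prime∤product pp p∤ns p∣ns

2∤1+n⇒2∣n : ∀ {n} → 2 ∤ suc n → 2 ∣ n
2∤1+n⇒2∣n {zero}        _     = ℕ∣.divides 0 refl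
2∤1+n⇒2∣n {suc zero}    2∤2   = contradiction (ℕ∣.∣-refl {2}) 2∤2
2∤1+n⇒2∣n {suc (suc n)} 2∤3+n = 2∣2+ (2∤1+n⇒2∣n (2∤3+n ∘ 2∣2+))
  where
  2∣2+ : ∀ {k} → 2 ∣ k → 2 ∣ 2 ℕ.+ k
  2∣2+ = ℕ∣.∣m∣n⇒∣m+n (ℕ∣.∣-refl {2})

pos-1+ab≡cd : ∀ a b c d → 1 ℕ.+ a ℕ.* b ≡ c ℕ.* d → + 1 ℤ.+ + a ℤ.* + b ≡ + c ℤ.* + d
pos-1+ab≡cd a b c d eq = trans (cong (ℤ._+_ (+ 1)) (sym (ℤ.pos-* a b))) (trans (cong +_ eq) (ℤ.pos-* c d))

module _ {m p : ℕ} .{{_ : NonZero m}} (m⊥p : Coprime m p) where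

  ∃-inverse-mod : ∃ λ u → + m ∣ℤ u ℤ.* + p ℤ.- + 1
  ∃-inverse-mod with coprime-Bézout m⊥p
  ... | Bézout.-+ x y 1+xm≡yp = + y , divides (+ x) (begin
    + y ℤ.* + p ℤ.- + 1          ≡⟨ cong (ℤ._- + 1) (pos-1+ab≡cd x m y p 1+xm≡yp) ⟨
    + 1 ℤ.+ + x ℤ.* + m ℤ.- + 1  ≡⟨ xyx⁻¹≈y (+ 1) (+ x ℤ.* + m) ⟩
    + x ℤ.* + m                  ∎)
    where open ≡-Reasoning
  ... | Bézout.+- x y 1+yp≡xm = ℤ.- + y , divides (ℤ.- + x) (begin
    ℤ.- + y ℤ.* + p ℤ.- + 1      ≡⟨ negate (+ y) (+ p) ⟩
    ℤ.- (+ 1 ℤ.+ + y ℤ.* + p)    ≡⟨ cong ℤ.-_ (pos-1+ab≡cd y p x m 1+yp≡xm) ⟩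
    ℤ.- (+ x ℤ.* + m)            ≡⟨ ℤ.neg-distribˡ-* (+ x) (+ m) ⟩
    ℤ.- + x ℤ.* + m              ∎)
    where
    open ≡-Reasoning
    negate : ∀ i j → ℤ.- i ℤ.* j ℤ.- + 1 ≡ ℤ.- (+ 1 ℤ.+ i ℤ.* j)
    negate = solve-∀

  ∃-residue : ∀ k → ∃ λ t → t < m × + m ∣ℤ + k ℤ.- + suc t ℤ.* + p
  ∃-residue k with u , m∣up-1 ← ∃-inverse-mod = t , n%ℕd<d a m , m∣k-[1+t]p
    where
    -- 1 + t ≡ k u (mod m), where u inverts p modulo m.
    a = + k ℤ.* u ℤ.- + 1
    t = a %ℕ m
    m∣a-t : + m ∣ℤ a ℤ.- + t
    m∣a-t = divides (a /ℕ m) (trans (cong (ℤ._- + t) (a≡a%ℕn+[a/ℕn]*n a m)) (xyx⁻¹≈y (+ t) _))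
    split : ∀ k u t p → ℤ.- k ℤ.* (u ℤ.* p ℤ.- + 1) ℤ.+ p ℤ.* (k ℤ.* u ℤ.- + 1 ℤ.- t) ≡ k ℤ.- (+ 1 ℤ.+ t) ℤ.* p
    split = solve-∀
    m∣k-[1+t]p : + m ∣ℤ + k ℤ.- + suc t ℤ.* + p
    m∣k-[1+t]p = subst (+ m ∣ℤ_) (split (+ k) u (+ t) (+ p))
                   (ℤ∣.∣m∣n⇒∣m+n (ℤ∣.∣n⇒∣m*n (ℤ.- + k) m∣up-1) (ℤ∣.∣n⇒∣m*n (+ p) m∣a-t))

  residue-unique : ∀ {k t t′} → t < m → t′ < m →
                   + m ∣ℤ + k ℤ.- + suc t ℤ.* + p → + m ∣ℤ + k ℤ.- + suc t′ ℤ.* + p → t ≡ t′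
  residue-unique {k} {t} {t′} t<m t′<m m∣k-[1+t]p m∣k-[1+t′]p = ∣∣a-b∣∧<⇒≡ m∣∣t-t′∣ t<m t′<m
    where
    difference : ∀ k t t′ p → k ℤ.- (+ 1 ℤ.+ t′) ℤ.* p ℤ.- (k ℤ.- (+ 1 ℤ.+ t) ℤ.* p) ≡ p ℤ.* (t ℤ.- t′)
    difference = solve-∀
    m∣p[t-t′] : + m ∣ℤ + p ℤ.* (+ t ℤ.- + t′)
    m∣p[t-t′] = subst (+ m ∣ℤ_) (difference (+ k) (+ t) (+ t′) (+ p)) (ℤ∣.∣m∣n⇒∣m-n m∣k-[1+t′]p m∣k-[1+t]p)
    m∣∣t-t′∣ : m ∣ ℤ.∣ + t ℤ.- + t′ ∣
    m∣∣t-t′∣ = coprime-divisor m⊥p (subst (m ∣_) (ℤ.abs-* (+ p) (+ t ℤ.- + t′)) (∣⇒∣ᵤ m∣p[t-t′]))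

module _ {a} {A : Set a} {x y : A} {m : ℕ} (z : ℤ) where

  if-divides?-true : m ∣ ℤ.∣ z ∣ → (if divides? m z then x else y) ≡ x
  if-divides?-true m∣z = cong (if_then x else y) (dec-true (m ∣? ℤ.∣ z ∣) m∣z)

  if-divides?-false : m ∤ ℤ.∣ z ∣ → (if divides? m z then x else y) ≡ y
  if-divides?-false m∤z = cong (if_then x else y) (dec-false (m ∣? ℤ.∣ z ∣) m∤z)

module Corollary {n : ℕ} (pp : Prime (suc n)) (p-odd : 2 ∤ suc n) (m : ℕ) .{{_ : NonZero m}} (p∤m : suc n ∤ m) where

  p : ℕ
  p = suc n

  m⊥p : Coprime m p
  m⊥p = Coprimality.sym (prime∧∤⇒coprime pp p∤m)

  -- Opaque because unfolding the Bézout computation behind residue makes type checking intractable.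
  opaque
    residue : ℕ → ℕ
    residue k = proj₁ (∃-residue m⊥p k)

    residue<m : ∀ k → residue k < m
    residue<m k = proj₁ (proj₂ (∃-residue m⊥p k))

    m∣k-[1+residue]p : ∀ k → + m ∣ℤ + k ℤ.- + suc (residue k) ℤ.* + p
    m∣k-[1+residue]p k = proj₂ (proj₂ (∃-residue m⊥p k))

  r : ℕ → ℕ
  r k = suc (residue k)

  m∣k-rp : ∀ k → + m ∣ℤ + k ℤ.- + r k ℤ.* + p
  m∣k-rp = m∣k-[1+residue]p

  ks : List ℕ
  ks = map suc (upTo n)

  S : ℚ
  S = sumℚ (map (λ k → fromℤ (+ r k) * inv k) ks)

  summand : ℕ → ℕ → ℚ
  summand k i = fromℤ (+ suc i) * (if divides? m (+ k ℤ.- + suc i ℤ.* + p) then inv k else 0ℚ)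

  sum-over-r : ∀ k → sumℚ (map (summand k) (upTo m)) ≡ fromℤ (+ r k) * inv k
  sum-over-r k = trans (sumℚ-map-single (upTo⁺ m) (∈-upTo⁺ (residue<m k)) vanish)
                       (cong (fromℤ (+ r k) *_) (if-divides?-true (+ k ℤ.- + r k ℤ.* + p) (∣⇒∣ᵤ (m∣k-rp k))))
    where
    vanish : ∀ {i} → i ∈ upTo m → i ≢ residue k → summand k i ≡ 0ℚ
    vanish {i} i∈upTo i≢residue = trans
      (cong (fromℤ (+ suc i) *_) (if-divides?-false (+ k ℤ.- + suc i ℤ.* + p) λ m∣k-[1+i]p →
         i≢residue (residue-unique m⊥p {k} (∈-upTo⁻ i∈upTo) (residue<m k) (∣ᵤ⇒∣ m∣k-[1+i]p) (m∣k-rp k))))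
      (ℚ.*-zeroʳ (fromℤ (+ suc i)))

  sum≡S : Σ[ 1 to m ] (λ r → (+ r) ℚ./ 1 * K p (+ r) m) ≡ S
  sum≡S = begin
    Σ[ 1 to m ] (λ r → (+ r) ℚ./ 1 * K p (+ r) m)
      ≡⟨ cong sumℚ (map-cong (λ i → *-distribˡ-sumℚ (fromℤ (+ suc i)) _ (upTo n)) (upTo m)) ⟩
    sumℚ (map (λ i → sumℚ (map (λ b → summand (suc b) i) (upTo n))) (upTo m))
      ≡⟨ sumℚ-map-comm (λ i b → summand (suc b) i) (upTo m) (upTo n) ⟩
    sumℚ (map (λ b → sumℚ (map (summand (suc b)) (upTo m))) (upTo n))
      ≡⟨ cong sumℚ (map-cong (λ b → sum-over-r (suc b)) (upTo n)) ⟩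
    sumℚ (map (λ b → fromℤ (+ r (suc b)) * inv (suc b)) (upTo n))
      ≡⟨ cong sumℚ (map-∘ (upTo n)) ⟩
    S ∎
    where open ≡-Reasoning

  ∈ks⇒bounds : ∀ {k} → k ∈ ks → 0 < k × k < p
  ∈ks⇒bounds k∈ks with b , b∈upTo , refl ← ∈-map⁻ suc k∈ks = z<s , s<s (∈-upTo⁻ b∈upTo)

  bounds⇒∈ks : ∀ {k} → 0 < k → k < p → k ∈ ks
  bounds⇒∈ks {suc b} _ (s<s b<n) = ∈-map⁺ suc (∈-upTo⁺ b<n)

  j : ℕ → ℕ
  j k = (r k ℕ.* p ℕ.∸ k) / m

  rp≡k+mj : ∀ {k} → k < p → r k ℕ.* p ≡ k ℕ.+ m ℕ.* j k
  rp≡k+mj {k} k<p = ∣ℤ⇒≡k+m*[n∸k]/m k≤rp (subst (λ x → + m ∣ℤ + k ℤ.- x) (sym (ℤ.pos-* (r k) p)) (m∣k-rp k))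
    where
    k≤rp : k ≤ r k ℕ.* p
    k≤rp = ℕ.≤-trans (ℕ.<⇒≤ k<p) (ℕ.m≤m+n p (residue k ℕ.* p))

  j∈ks : ∀ {k} → k ∈ ks → j k ∈ ks
  j∈ks {k} k∈ks with 0<k , k<p ← ∈ks⇒bounds k∈ks = bounds⇒∈ks 0<j j<p
    where
    0<j : 0 < j k
    0<j = ℕ.n≢0⇒n>0 λ j≡0 → ℕ.<⇒≱ k<p (begin
      p                   ≤⟨ ℕ.m≤m+n p (residue k ℕ.* p) ⟩
      r k ℕ.* p           ≡⟨ rp≡k+mj k<p ⟩
      k ℕ.+ m ℕ.* j k     ≡⟨ cong (λ x → k ℕ.+ m ℕ.* x) j≡0 ⟩
      k ℕ.+ m ℕ.* 0       ≡⟨ cong (k ℕ.+_) (ℕ.*-zeroʳ m) ⟩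
      k ℕ.+ 0             ≡⟨ ℕ.+-identityʳ k ⟩
      k                   ∎)
      where open ℕ.≤-Reasoning
    j<p : j k < p
    j<p = ℕ.*-cancelˡ-< m (j k) p (begin-strict
      m ℕ.* j k           <⟨ ℕ.m<n+m (m ℕ.* j k) 0<k ⟩
      k ℕ.+ m ℕ.* j k     ≡⟨ rp≡k+mj k<p ⟨
      r k ℕ.* p           ≤⟨ ℕ.*-monoˡ-≤ p (residue<m k) ⟩
      m ℕ.* p             ∎)
      where open ℕ.≤-Reasoning

  j-injective : ∀ {k k′} → k ∈ ks → k′ ∈ ks → j k ≡ j k′ → k ≡ k′
  j-injective {k} {k′} k∈ks k′∈ks jk≡jk′ = ∣∣a-b∣∧<⇒≡ p∣∣k-k′∣ k<p k′<p
    where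
    k<p  = proj₂ (∈ks⇒bounds k∈ks)
    k′<p = proj₂ (∈ks⇒bounds k′∈ks)
    add-both : ∀ a b c → a ℤ.- b ≡ (a ℤ.+ c) ℤ.- (b ℤ.+ c)
    add-both = solve-∀
    factor : ∀ a b c → a ℤ.* c ℤ.- b ℤ.* c ≡ (a ℤ.- b) ℤ.* c
    factor = solve-∀
    k-k′≡[r-r′]p : + k ℤ.- + k′ ≡ (+ r k ℤ.- + r k′) ℤ.* + p
    k-k′≡[r-r′]p = begin
      + k ℤ.- + k′                                        ≡⟨ add-both (+ k) (+ k′) (+ (m ℕ.* j k)) ⟩
      + (k ℕ.+ m ℕ.* j k) ℤ.- + (k′ ℕ.+ m ℕ.* j k)        ≡⟨ cong (λ x → + (k ℕ.+ m ℕ.* j k) ℤ.- + (k′ ℕ.+ m ℕ.* x)) jk≡jk′ ⟩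
      + (k ℕ.+ m ℕ.* j k) ℤ.- + (k′ ℕ.+ m ℕ.* j k′)       ≡⟨ cong₂ (λ x y → + x ℤ.- + y) (rp≡k+mj k<p) (rp≡k+mj k′<p) ⟨
      + (r k ℕ.* p) ℤ.- + (r k′ ℕ.* p)                    ≡⟨ cong₂ ℤ._-_ (ℤ.pos-* (r k) p) (ℤ.pos-* (r k′) p) ⟩
      + r k ℤ.* + p ℤ.- + r k′ ℤ.* + p                    ≡⟨ factor (+ r k) (+ r k′) (+ p) ⟩
      (+ r k ℤ.- + r k′) ℤ.* + p                          ∎
      where open ≡-Reasoning
    p∣∣k-k′∣ : p ∣ ℤ.∣ + k ℤ.- + k′ ∣
    p∣∣k-k′∣ = subst (p ∣_) (sym (trans (cong ℤ.∣_∣ k-k′≡[r-r′]p) (ℤ.abs-* (+ r k ℤ.- + r k′) (+ p))))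
                     (ℕ∣.n∣m*n ℤ.∣ + r k ℤ.- + r k′ ∣)

  length-ks : length ks ≡ n
  length-ks = trans (length-map suc (upTo n)) (length-upTo n)

  A : ℕ
  A = product ks

  Π≡A : productℤ (map +_ ks) ≡ + A
  Π≡A = trans (productℤ-map-pos (λ k → k) ks) (cong (+_ ∘ product) (map-id ks))

  p∤A : p ∤ A
  p∤A = prime∤product pp (All.tabulate λ k∈ks → let 0<k , k<p = ∈ks⇒bounds k∈ks in ℕ∣.>⇒∤ {{ℕ.>-nonZero 0<k}} k<p)

  product-k-pr≡m^n*A : productℤ (map (λ k → + k ℤ.- + p ℤ.* + r k) ks) ≡ + (m ^ n ℕ.* A)
  product-k-pr≡m^n*A = begin
    productℤ (map (λ k → + k ℤ.- + p ℤ.* + r k) ks) ≡⟨ cong productℤ (map-cong-local (All.tabulate k-pr≡-mj)) ⟩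
    productℤ (map (λ k → ℤ.- + (m ℕ.* j k)) ks)     ≡⟨ productℤ-map-neg _ ks (subst (2 ∣_) (sym length-ks) (2∤1+n⇒2∣n p-odd)) ⟩
    productℤ (map (λ k → + (m ℕ.* j k)) ks)         ≡⟨ productℤ-map-pos _ ks ⟩
    + product (map (λ k → m ℕ.* j k) ks)            ≡⟨ cong +_ (product-map-* m j ks) ⟩
    + (m ^ length ks ℕ.* product (map j ks))        ≡⟨ cong₂ (λ l P → + (m ^ l ℕ.* P)) length-ks (product-↭ j[ks]↭ks) ⟩
    + (m ^ n ℕ.* A)                                 ∎
    where
    open ≡-Reasoning
    j[ks]↭ks = injective-endo⇒map↭ (Unique-map⁺ ℕ.suc-injective (upTo⁺ n)) j∈ks j-injective
    cancel : ∀ a b → a ℤ.- (a ℤ.+ b) ≡ ℤ.- b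
    cancel = solve-∀
    k-pr≡-mj : ∀ {k} → k ∈ ks → + k ℤ.- + p ℤ.* + r k ≡ ℤ.- + (m ℕ.* j k)
    k-pr≡-mj {k} k∈ks = begin
      + k ℤ.- + p ℤ.* + r k              ≡⟨ cong (ℤ._-_ (+ k)) (trans (ℤ.*-comm (+ p) (+ r k)) (sym (ℤ.pos-* (r k) p))) ⟩
      + k ℤ.- + (r k ℕ.* p)              ≡⟨ cong (λ x → + k ℤ.- + x) (rp≡k+mj (proj₂ (∈ks⇒bounds k∈ks))) ⟩
      + k ℤ.- (+ k ℤ.+ + (m ℕ.* j k))    ≡⟨ cancel (+ k) (+ (m ℕ.* j k)) ⟩
      ℤ.- + (m ℕ.* j k)                  ∎

  D : ℤ
  D = linearTerm +_ (λ k → + r k) ks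

  T : ℤ
  T = proj₁ (productℤ-expansion (+ p) +_ (λ k → + r k) ks)

  m^n*A≡A-pD+ppT : + (m ^ n) ℤ.* + A ≡ + A ℤ.- + p ℤ.* D ℤ.+ + p ℤ.* + p ℤ.* T
  m^n*A≡A-pD+ppT = begin
    + (m ^ n) ℤ.* + A                                  ≡⟨ ℤ.pos-* (m ^ n) A ⟨
    + (m ^ n ℕ.* A)                                    ≡⟨ product-k-pr≡m^n*A ⟨
    productℤ (map (λ k → + k ℤ.- + p ℤ.* + r k) ks)    ≡⟨ proj₂ (productℤ-expansion (+ p) +_ (λ k → + r k) ks) ⟩
    productℤ (map +_ ks) ℤ.- + p ℤ.* D ℤ.+ + p ℤ.* + p ℤ.* T ≡⟨ cong (λ x → x ℤ.- + p ℤ.* D ℤ.+ + p ℤ.* + p ℤ.* T) Π≡A ⟩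
    + A ℤ.- + p ℤ.* D ℤ.+ + p ℤ.* + p ℤ.* T             ∎
    where open ≡-Reasoning

  [m^n-1]A≡p[pT-D] : (+ (m ^ n) ℤ.- + 1) ℤ.* + A ≡ + p ℤ.* (+ p ℤ.* T ℤ.- D)
  [m^n-1]A≡p[pT-D] = trans (expand (+ (m ^ n)) (+ A)) (trans (cong (ℤ._- + A) m^n*A≡A-pD+ppT) (collect (+ A) (+ p) D T))
    where
    expand : ∀ M A → (M ℤ.- + 1) ℤ.* A ≡ M ℤ.* A ℤ.- A
    expand = solve-∀
    collect : ∀ A P D T → A ℤ.- P ℤ.* D ℤ.+ P ℤ.* P ℤ.* T ℤ.- A ≡ P ℤ.* (P ℤ.* T ℤ.- D)
    collect = solve-∀

  p∣[m^n-1]A : p ∣ ℤ.∣ + (m ^ n) ℤ.- + 1 ∣ ℕ.* A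
  p∣[m^n-1]A = subst (p ∣_) (begin
    p ℕ.* ℤ.∣ + p ℤ.* T ℤ.- D ∣            ≡⟨ ℤ.abs-* (+ p) (+ p ℤ.* T ℤ.- D) ⟨
    ℤ.∣ + p ℤ.* (+ p ℤ.* T ℤ.- D) ∣        ≡⟨ cong ℤ.∣_∣ [m^n-1]A≡p[pT-D] ⟨
    ℤ.∣ (+ (m ^ n) ℤ.- + 1) ℤ.* + A ∣      ≡⟨ ℤ.abs-* (+ (m ^ n) ℤ.- + 1) (+ A) ⟩
    ℤ.∣ + (m ^ n) ℤ.- + 1 ∣ ℕ.* A          ∎) (ℕ∣.m∣m*n ℤ.∣ + p ℤ.* T ℤ.- D ∣)
    where open ≡-Reasoning

  -- Fermat's little theorem falls out of the product identity.
  p∣m^n-1 : + p ∣ℤ + (m ^ n) ℤ.- + 1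
  p∣m^n-1 with euclidsLemma ℤ.∣ + (m ^ n) ℤ.- + 1 ∣ A pp p∣[m^n-1]A
  ... | inj₁ p∣m^n-1 = ∣ᵤ⇒∣ p∣m^n-1
  ... | inj₂ p∣A     = contradiction p∣A p∤A

  ∃-fermatQuotient : ∃ λ q → + (m ^ n) ℤ.- + 1 ≡ q ℤ.* + p × q ℤ.* + A ≡ + p ℤ.* T ℤ.- D
  ∃-fermatQuotient with divides q m^n-1≡qp ← p∣m^n-1 = q , m^n-1≡qp , ℤ.*-cancelˡ-≡ (+ p) _ _ (begin
      + p ℤ.* (q ℤ.* + A)              ≡⟨ rearrange (+ p) q (+ A) ⟩
      (q ℤ.* + p) ℤ.* + A              ≡⟨ cong (ℤ._* + A) m^n-1≡qp ⟨
      (+ (m ^ n) ℤ.- + 1) ℤ.* + A      ≡⟨ [m^n-1]A≡p[pT-D] ⟩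
      + p ℤ.* (+ p ℤ.* T ℤ.- D)        ∎)
    where
    open ≡-Reasoning
    rearrange : ∀ a b c → a ℤ.* (b ℤ.* c) ≡ (b ℤ.* a) ℤ.* c
    rearrange = solve-∀

  q : ℤ
  q = proj₁ ∃-fermatQuotient

  fermatQuotient≡q : fermatQuotient p pp m ≡ fromℤ q
  fermatQuotient≡q = trans (cong (ℚ._/ p) (proj₁ (proj₂ ∃-fermatQuotient))) (i*n/n≡i q p)

  [S+q]A≡pT : (S - (- fermatQuotient p pp m)) * fromℤ (+ A) ≡ fromℤ (+ p ℤ.* T)
  [S+q]A≡pT = begin
    (S - (- fermatQuotient p pp m)) * fromℤ (+ A)   ≡⟨ cong (λ x → (S - (- x)) * fromℤ (+ A)) fermatQuotient≡q ⟩
    (S - (- fromℤ q)) * fromℤ (+ A)                 ≡⟨ distribute S (fromℤ q) (fromℤ (+ A)) ⟩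
    fromℤ (+ A) * S + fromℤ q * fromℤ (+ A)         ≡⟨ cong₂ _+_ D≡AS (fromℤ-homo-* q (+ A)) ⟨
    fromℤ D + fromℤ (q ℤ.* + A)                     ≡⟨ fromℤ-homo-+ D (q ℤ.* + A) ⟨
    fromℤ (D ℤ.+ q ℤ.* + A)                         ≡⟨ cong (λ x → fromℤ (D ℤ.+ x)) (proj₂ (proj₂ ∃-fermatQuotient)) ⟩
    fromℤ (D ℤ.+ (+ p ℤ.* T ℤ.- D))                 ≡⟨ cong fromℤ (cancel D (+ p ℤ.* T)) ⟩
    fromℤ (+ p ℤ.* T)                               ∎
    where
    open ≡-Reasoning
    distribute : ∀ σ κ α → (σ - (- κ)) * α ≡ α * σ + κ * α
    distribute = RingSolver.solve-∀ ℚ-ring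
    cancel : ∀ d x → d ℤ.+ (x ℤ.- d) ≡ x
    cancel = solve-∀
    D≡AS : fromℤ D ≡ fromℤ (+ A) * S
    D≡AS = trans (fromℤ-linearTerm (λ k → + r k) ks (All.tabulate (ℕ.>-nonZero ∘ proj₁ ∘ ∈ks⇒bounds)))
                 (cong (λ x → fromℤ x * S) Π≡A)

corollary2p2 : (p : ℕ) (pp : Prime p) → ¬ (2 ∣ p) → (m : ℕ) → m > 0 → ¬ (p ∣ m) →
    (Σ[ 1 to m ] (λ r → Data.Rational._/_ (+ r) 1 * K p (+ r) m))
      ≡ (- fermatQuotient p pp m) [modℚ p ]
corollary2p2 zero    pp = contradiction pp ¬prime[0]
corollary2p2 (suc n) pp p-odd m m>0 p∤m =
  subst (_≡ - fermatQuotient (suc n) pp m [modℚ suc n ]) (sym sum≡S)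
    (multiple-of-p⇒≡[modℚ] pp S (- fermatQuotient p pp m) T p∤A [S+q]A≡pT)
  where open Corollary pp p-odd m {{ℕ.>-nonZero m>0}} p∤m
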